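{- Let $t<k$ be positive integers, $1\le i<j\le k$, and $p,q\ge0$ integers. If a $(\bar{1},t)$-LA$(N_1;k,(v_1,\dots,v_k))$, a $(\bar{1},t-1)$-LA$(N_2;k-1,(v_1,\dots,v_{i-1},v_{i+1},\dots,v_k))$, a $(\bar{1},t-1)$-LA$(N_3;k-1,(v_1,\dots,v_{j-1},v_{j+1},\dots,v_k))$ and a $(\bar{1},t-2)$-LA$(N_4;k-2,(v_1,\dots,v_{i-1},v_{i+1},\dots,v_{j-1},v_{j+1},\dots,v_k))$ exist, then a $(\bar{1},t)$-LA$(N;k,(v_1,\dots,v_{i-1},v_i+p,v_{i+1},\dots,v_{j-1},v_j+q,v_{j+1},\dots,v_k))$ exists, where $N=N_1+pN_2+qN_3+pqN_4$.
   Context: For positive integers $N,k,t$ and $v_1,\dots,v_k$, consider $N\times k$ arrays $A=(a_{rj})$ whose $j$-th column has entries from a set $V_j$ with $|V_j|=v_j$. A $t$-way interaction is $T=\{(j,\sigma_j):j\in I\}$ with $I\subseteq\{1,\dots,k\}$, $|I|=t$, $\sigma_j\in V_j$; $\rho(A,T)$ is the set of rows $r$ with $a_{rj}=\sigma_j$ for all $j\in I$, and $\rho(A,\mathcal T)=\bigcup_{T\in\mathcal T}\rho(A,T)$. $A$ is a $(\bar1,t)$-LA$(N;k,(v_1,\dots,v_k))$ if for all sets $\mathcal T_1,\mathcal T_2$ of $t$-way interactions with $|\mathcal T_1|,|\mathcal T_2|\le 1$: $\rho(A,\mathcal T_1)=\rho(A,\mathcal T_2)\iff\mathcal T_1=\mathcal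 T_2$ (equivalently: every $t$-way interaction occurs in some row and distinct interactions have distinct $\rho$). -}

module Defs where

open import Data.Nat using (ℕ; zero; suc; _+_)
open import Data.Fin using (Fin; zero; suc; punchOut; _<_)
open import Data.Fin.Properties using (<⇒≢)
open import Data.Maybe using (Maybe; just; nothing)
open import Data.Vec.Functional using (Vector; removeAt)
open import Data.Product using (Σ; _×_)
open import Data.Unit using (⊤)
open import Data.Empty using (⊥)
open import Relation.Binary.PropositionalEquality using (_≡_)

Array : (N k : ℕ) → (Fin k → ℕ) → Set
Array N k v = Fin N → (c : Fin k) → Fin (v c)

-- An interaction {(c, σ_c) : c ∈ I} encoded canonically as a partial
-- function: T c = just σ_c if c ∈ I, nothing otherwise.
Interaction : (k : ℕ) → (Fin k → ℕ) → Set
Interaction k v = (c : Fin k) → Maybe (Fin (v c))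

size : ∀ {k} {v : Fin k → ℕ} → Interaction k v → ℕ
size {zero}  T = 0
size {suc k} T = here (T zero) + size {k} (λ c → T (suc c))
  where
  here : ∀ {A : Set} → Maybe A → ℕ
  here (just _) = 1
  here nothing  = 0

_≈I_ : ∀ {k} {v : Fin k → ℕ} → Interaction k v → Interaction k v → Set
T₁ ≈I T₂ = ∀ c → T₁ c ≡ T₂ c

Covers : ∀ {N k} {v : Fin k → ℕ} → Array N k v → Interaction k v → Fin N → Set
Covers A T r = ∀ c σ → T c ≡ just σ → A r c ≡ σ

-- Sets 𝒯 of interactions with |𝒯| ≤ 1: nothing = ∅, just T = {T}.
SmallSet : (k : ℕ) → (Fin k → ℕ) → Set
SmallSet k v = Maybe (Interaction k v)

TWay : ∀ {k} {v : Fin k → ℕ} → ℕ → SmallSet k v → Set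
TWay t nothing  = ⊤
TWay t (just T) = size T ≡ t

InRho : ∀ {N k} {v : Fin k → ℕ} → Array N k v → SmallSet k v → Fin N → Set
InRho A nothing  r = ⊥
InRho A (just T) r = Covers A T r

SameRho : ∀ {N k} {v : Fin k → ℕ} → Array N k v → SmallSet k v → SmallSet k v → Set
SameRho A 𝒯₁ 𝒯₂ = ∀ r → (InRho A 𝒯₁ r → InRho A 𝒯₂ r) × (InRho A 𝒯₂ r → InRho A 𝒯₁ r)

_≈S_ : ∀ {k} {v : Fin k → ℕ} → SmallSet k v → SmallSet k v → Set
nothing ≈S nothing = ⊤
nothing ≈S just _  = ⊥
just _  ≈S nothing = ⊥
just T₁ ≈S just T₂ = T₁ ≈I T₂

IsLA : ∀ {N k} {v : Fin k → ℕ} → ℕ → Array N k v → Set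
IsLA {k = k} {v} t A = ∀ (𝒯₁ 𝒯₂ : SmallSet k v) → TWay t 𝒯₁ → TWay t 𝒯₂ →
  (SameRho A 𝒯₁ 𝒯₂ → 𝒯₁ ≈S 𝒯₂) × (𝒯₁ ≈S 𝒯₂ → SameRho A 𝒯₁ 𝒯₂)

LAExists : (t N k : ℕ) → (Fin k → ℕ) → Set
LAExists t N k v = Σ (Array N k v) (IsLA t)

remove2 : ∀ {n} (v : Vector ℕ (suc (suc n))) (i j : Fin (suc (suc n))) → i < j → Vector ℕ n
remove2 v i j i<j = removeAt (removeAt v i) (punchOut (<⇒≢ i<j))

module Submission where

-- Widening column m of a strength-t locating array from u_m to u_m + p
-- symbols costs p·N′ rows, where N′ is the size of a strength-(t − 1)
-- locating array on the other columns: keep the old rows and, for every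
-- fresh symbol z, append a copy of the smaller array with z inserted in
-- column m. An interaction without fresh symbols is located by the old
-- rows, which contain no fresh symbol; an interaction with the fresh symbol
-- z in column m is located inside the block of z, where it reduces to a
-- (t − 1)-way interaction on the remaining columns. Widening column j by q,
-- both in the t-way array and one level down in the (t − 1)-way array
-- without column i (trivially when t = 1), and then column i by p gives
-- N₁ + qN₃ + p(N₂ + qN₄) rows.

open import Defs
open import Data.Nat using (ℕ; zero; suc; _+_; _*_; _<_; _≤_; pred)
open import Data.Nat.Properties using (+-comm; +-identityʳ; m+n≡0⇒m≡0; +-commutativeSemigroup)
open import Data.Nat.Tactic.RingSolver using (solve-∀)
open import Algebra.Properties.CommutativeSemigroup +-commutativeSemigroup using (x∙yz≈y∙xz; xy∙z≈xz∙y)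
open import Data.Fin using (Fin; zero; suc; punchIn; punchOut; cast; splitAt; join; remQuot; combine; _↑ˡ_; _↑ʳ_)
open import Data.Fin.Properties
  using (_≟_; any?; all?; ¬Fin0; cast-involutive; splitAt-↑ˡ; splitAt-↑ʳ; splitAt⁻¹-↑ˡ; splitAt⁻¹-↑ʳ;
         splitAt-join; remQuot-combine; punchInᵢ≢i; punchIn-punchOut; punchIn-injective; <⇒≢)
open import Data.Maybe using (Maybe; just; nothing; _>>=_; map)
open import Data.Maybe.Properties using (just-injective)
open import Data.Maybe.Relation.Unary.All using (All; just; nothing; universal)
open import Data.Product using (∃-syntax; _×_; _,_; proj₁; proj₂)
open import Data.Sum using (_⊎_; inj₁; inj₂; [_,_]′; map₁; map₂)
import Data.Sum as Sum
open import Data.Unit using (tt)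
open import Data.Empty using (⊥-elim)
open import Relation.Nullary using (Dec; yes; no; ¬_; contradiction)
open import Relation.Binary.PropositionalEquality
  using (_≡_; _≢_; refl; sym; trans; cong; cong₂; subst; module ≡-Reasoning)
open import Function using (_∘_)
open import Function.Definitions using (StrictlySurjective)
open import Data.Vec.Functional using (removeAt; updateAt)
open import Data.Vec.Functional.Properties using (updateAt-updates; updateAt-minimal)

open ≡-Reasoning

weight : ∀ {A : Set} → Maybe A → ℕ
weight (just _) = 1
weight nothing  = 0

size-suc : ∀ {k} {v : Fin (suc k) → ℕ} (T : Interaction (suc k) v) →
           size T ≡ weight (T zero) + size (T ∘ suc)
size-suc T with T zero
... | just _  = refl
... | nothing = refl

size-cong : ∀ {k} {v v′ : Fin k → ℕ} (T : Interaction k v) (T′ : Interaction k v′) →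
            (∀ c → weight (T c) ≡ weight (T′ c)) → size T ≡ size T′
size-cong {zero}  T T′ h = refl
size-cong {suc k} T T′ h = begin
  size T                              ≡⟨ size-suc T ⟩
  weight (T zero) + size (T ∘ suc)    ≡⟨ cong₂ _+_ (h zero) (size-cong (T ∘ suc) (T′ ∘ suc) (h ∘ suc)) ⟩
  weight (T′ zero) + size (T′ ∘ suc)  ≡⟨ sym (size-suc T′) ⟩
  size T′                             ∎

size-punchIn : ∀ {k} {v : Fin (suc k) → ℕ} (T : Interaction (suc k) v) m →
               size T ≡ weight (T m) + size (T ∘ punchIn m)
size-punchIn T zero = size-suc T
size-punchIn {suc k} T (suc m) = begin
  size T
    ≡⟨ size-suc T ⟩
  weight (T zero) + size (T ∘ suc)
    ≡⟨ cong (weight (T zero) +_) (size-punchIn (T ∘ suc) m) ⟩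
  weight (T zero) + (weight (T (suc m)) + size (T ∘ suc ∘ punchIn m))
    ≡⟨ x∙yz≈y∙xz (weight (T zero)) (weight (T (suc m))) _ ⟩
  weight (T (suc m)) + (weight (T zero) + size (T ∘ suc ∘ punchIn m))
    ≡⟨ cong (weight (T (suc m)) +_) (sym (size-suc (T ∘ punchIn (suc m)))) ⟩
  weight (T (suc m)) + size (T ∘ punchIn (suc m))
    ∎

size-punchIn-just : ∀ {k} {v : Fin (suc k) → ℕ} (T : Interaction (suc k) v) m {σ} →
                    T m ≡ just σ → size T ≡ suc (size (T ∘ punchIn m))
size-punchIn-just T m T[m]≡σ =
  trans (size-punchIn T m) (cong (λ x → weight x + size (T ∘ punchIn m)) T[m]≡σ)

size≡0⇒nothing : ∀ {k} {v : Fin k → ℕ} (T : Interaction k v) → size T ≡ 0 → ∀ c → T c ≡ nothing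
size≡0⇒nothing {suc k} T size≡0 c =
  weight≡0 (T c) (m+n≡0⇒m≡0 _ (trans (sym (size-punchIn T c)) size≡0))
  where
  weight≡0 : ∀ {A : Set} (x : Maybe A) → weight x ≡ 0 → x ≡ nothing
  weight≡0 nothing _ = refl

size-empty : ∀ {k} {v : Fin k → ℕ} → size {k} {v} (λ _ → nothing) ≡ 0
size-empty {zero}      = refl
size-empty {suc k} {v} = size-empty {k} {v ∘ suc}

-- Locating arrays as covering and separating row families

Row : (k : ℕ) → (Fin k → ℕ) → Set
Row k v = (c : Fin k) → Fin (v c)

MatchesAt : ∀ {n} → Fin n → Maybe (Fin n) → Set
MatchesAt x my = ∀ σ → my ≡ just σ → x ≡ σ

Matches : ∀ {k} {v : Fin k → ℕ} → Row k v → Interaction k v → Set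
Matches f T = ∀ c → MatchesAt (f c) (T c)

matchesAt? : ∀ {n} (x : Fin n) my → Dec (MatchesAt x my)
matchesAt? x nothing  = yes (λ _ ())
matchesAt? x (just y) with x ≟ y
... | yes x≡y = yes (λ _ e → trans x≡y (just-injective e))
... | no  x≢y = no (λ h → x≢y (h y refl))

module _ {k} {v : Fin k → ℕ} {I : Set} where

  SameRows : (I → Row k v) → Interaction k v → Interaction k v → Set
  SameRows R T₁ T₂ =
    ∀ i → (Matches (R i) T₁ → Matches (R i) T₂) × (Matches (R i) T₂ → Matches (R i) T₁)

  Covering : ℕ → (I → Row k v) → Set
  Covering t R = ∀ T → size T ≡ t → ∃[ i ] Matches (R i) T

  Separating : ℕ → (I → Row k v) → Set
  Separating t R = ∀ T₁ T₂ → size T₁ ≡ t → size T₂ ≡ t → SameRows R T₁ T₂ → T₁ ≈I T₂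

module _ {k} {v : Fin k → ℕ} {I J : Set} {t : ℕ} {R : I → Row k v} {f : J → I}
         (f-surjective : StrictlySurjective _≡_ f) where

  covering-∘ : Covering t R → Covering t (R ∘ f)
  covering-∘ cov T size≡t with cov T size≡t
  ... | i , h with f-surjective i
  ...   | j , refl = j , h

  separating-∘ : Separating t R → Separating t (R ∘ f)
  separating-∘ sep T₁ T₂ s₁ s₂ same = sep T₁ T₂ s₁ s₂ same′
    where
    same′ : SameRows R T₁ T₂
    same′ i with f-surjective i
    ... | j , refl = same j

module _ {N k} {v : Fin k → ℕ} {t : ℕ} {A : Array N k v} where

  isLA : Covering t A → Separating t A → IsLA t A
  isLA cov sep nothing  nothing  _  _  = (λ _ → tt) , (λ _ _ → (λ ()) , (λ ()))
  isLA cov sep nothing  (just T) _  s  = (λ same → let (r , h) = cov T s in proj₂ (same r) h) , λ ()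
  isLA cov sep (just T) nothing  s  _  = (λ same → let (r , h) = cov T s in proj₁ (same r) h) , λ ()
  isLA cov sep (just T₁) (just T₂) s₁ s₂ =
    sep T₁ T₂ s₁ s₂ ,
    λ T₁≈T₂ r → (λ h c σ e → h c σ (trans (T₁≈T₂ c) e)) ,
                (λ h c σ e → h c σ (trans (sym (T₁≈T₂ c)) e))

  isLA⇒separating : IsLA t A → Separating t A
  isLA⇒separating la T₁ T₂ s₁ s₂ = proj₁ (la (just T₁) (just T₂) s₁ s₂)

  -- IsLA only refutes ρ(A, T) = ∅; matching is decidable and there are
  -- finitely many rows, so a matching row can be found.
  isLA⇒covering : IsLA t A → Covering t A
  isLA⇒covering la T s with any? (λ r → all? (λ c → matchesAt? (A r c) (T c)))
  ... | yes found = found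
  ... | no  none  = ⊥-elim (proj₁ (la nothing (just T) tt s) (λ r → (λ ()) , (λ h → none (r , h))))

nonempty⇒isLA₀ : ∀ {N k} {v : Fin k → ℕ} (A : Array N k v) → Fin N → IsLA 0 A
nonempty⇒isLA₀ A r = isLA
  (λ T s → r , λ c σ e → contradiction (trans (sym (size≡0⇒nothing T s c)) e) λ ())
  (λ T₁ T₂ s₁ s₂ _ c → trans (size≡0⇒nothing T₁ s₁ c) (sym (size≡0⇒nothing T₂ s₂ c)))

LAExists₀-extend : ∀ {M k} {u w : Fin k → ℕ} → LAExists 0 M k u →
                   (∀ c → Fin (u c) → Fin (w c)) → ∀ L → LAExists 0 (M + L) k w
LAExists₀-extend {M} {k} {u} {w} (A , la) embed L = B , nonempty⇒isLA₀ B (r ↑ˡ L)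
  where
  r : Fin M
  r = proj₁ (isLA⇒covering la (λ _ → nothing) (size-empty {v = u}))
  B : Array (M + L) k w
  B _ c = embed c (A r c)

insert : ∀ {k} {P : Fin (suc k) → Set} (m : Fin (suc k)) →
         P m → ((c : Fin k) → P (punchIn m c)) → (c : Fin (suc k)) → P c
insert                 zero    x f zero    = x
insert                 zero    x f (suc c) = f c
insert {suc k}         (suc m) x f zero    = f zero
insert {suc k} {P = P} (suc m) x f (suc c) = insert {P = P ∘ suc} m x (f ∘ suc) c

insert-at : ∀ {k} {P : Fin (suc k) → Set} m (x : P m) f → insert {P = P} m x f m ≡ x
insert-at                 zero    x f = refl
insert-at {suc k} {P = P} (suc m) x f = insert-at {P = P ∘ suc} m x (f ∘ suc)

insert-punchIn : ∀ {k} {P : Fin (suc k) → Set} m (x : P m) f c →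
                 insert {P = P} m x f (punchIn m c) ≡ f c
insert-punchIn                 zero    x f c       = refl
insert-punchIn {suc k}         (suc m) x f zero    = refl
insert-punchIn {suc k} {P = P} (suc m) x f (suc c) = insert-punchIn {P = P ∘ suc} m x (f ∘ suc) c

module _ {k} {w : Fin (suc k) → ℕ} {T : Interaction (suc k) w} {m} {x : Fin (w m)}
         {f : (c : Fin k) → Fin (w (punchIn m c))} where

  matches-insert : MatchesAt x (T m) → Matches f (T ∘ punchIn m) → Matches (insert m x f) T
  matches-insert hx hf = insert {P = λ c → MatchesAt (insert m x f c) (T c)} m
    (subst (λ y → MatchesAt y (T m)) (sym (insert-at m x f)) hx)
    (λ c → subst (λ y → MatchesAt y (T (punchIn m c))) (sym (insert-punchIn m x f c)) (hf c))

  insert-matchesAt : Matches (insert m x f) T → MatchesAt x (T m)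
  insert-matchesAt h = subst (λ y → MatchesAt y (T m)) (insert-at m x f) (h m)

  insert-matches-punchIn : Matches (insert m x f) T → Matches f (T ∘ punchIn m)
  insert-matches-punchIn h c =
    subst (λ y → MatchesAt y (T (punchIn m c))) (insert-punchIn m x f c) (h (punchIn m c))

-- Fin b as an embedded copy of Fin a together with p fresh symbols

record Extension (a b p : ℕ) : Set where
  field
    embed         : Fin a → Fin b
    fresh         : Fin p → Fin b
    unembed       : Fin b → Maybe (Fin a)
    unembed-embed : ∀ x → unembed (embed x) ≡ just x
    unembed-fresh : ∀ z → unembed (fresh z) ≡ nothing
    embed-unembed : ∀ {x y} → unembed y ≡ just x → embed x ≡ y
    fresh-unembed : ∀ {y} → unembed y ≡ nothing → ∃[ z ] fresh z ≡ y

  Embedded : Fin b → Set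
  Embedded y = ∃[ x ] embed x ≡ y

  embed-injective : ∀ {x x′} → embed x ≡ embed x′ → x ≡ x′
  embed-injective {x} {x′} e = just-injective (begin
    just x                ≡⟨ sym (unembed-embed x) ⟩
    unembed (embed x)     ≡⟨ cong unembed e ⟩
    unembed (embed x′)    ≡⟨ unembed-embed x′ ⟩
    just x′               ∎)

  embed≢fresh : ∀ x z → embed x ≢ fresh z
  embed≢fresh x z e =
    contradiction (trans (sym (unembed-embed x)) (trans (cong unembed e) (unembed-fresh z))) λ ()

  embedded-or-fresh : ∀ y → Embedded y ⊎ ∃[ z ] fresh z ≡ y
  embedded-or-fresh y with unembed y in e
  ... | just x  = inj₁ (x , embed-unembed e)
  ... | nothing = inj₂ (fresh-unembed e)

  pull : Maybe (Fin b) → Maybe (Fin a)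
  pull my = my >>= unembed

  pull-matchesAt : ∀ {x} my → MatchesAt (embed x) my → MatchesAt x (pull my)
  pull-matchesAt (just y) h x′ e = embed-injective (trans (h y refl) (sym (embed-unembed e)))

  embed-matchesAt : ∀ {x my} → All Embedded my → MatchesAt x (pull my) → MatchesAt (embed x) my
  embed-matchesAt (just (x′ , refl)) h _ refl = cong embed (h x′ (unembed-embed x′))

  weight-pull : ∀ {my} → All Embedded my → weight (pull my) ≡ weight my
  weight-pull nothing           = refl
  weight-pull (just (x , refl)) = cong weight (unembed-embed x)

  map-embed-pull : ∀ {my} → All Embedded my → map embed (pull my) ≡ my
  map-embed-pull nothing           = refl
  map-embed-pull (just (x , refl)) = cong (map embed) (unembed-embed x)

castExtension : ∀ {a b p} → b ≡ a + p → Extension a b p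
castExtension {a} {b} {p} b≡a+p = record
  { embed         = embed
  ; fresh         = fresh
  ; unembed       = unembed
  ; unembed-embed = λ x → cong [ just , (λ _ → nothing) ]′
      (trans (cong (splitAt a) (cast-involutive b≡a+p (sym b≡a+p) (x ↑ˡ p))) (splitAt-↑ˡ a x p))
  ; unembed-fresh = λ z → cong [ just , (λ _ → nothing) ]′
      (trans (cong (splitAt a) (cast-involutive b≡a+p (sym b≡a+p) (a ↑ʳ z))) (splitAt-↑ʳ a p z))
  ; embed-unembed = embed-unembed
  ; fresh-unembed = fresh-unembed
  }
  where
  embed : Fin a → Fin b
  embed x = cast (sym b≡a+p) (x ↑ˡ p)

  fresh : Fin p → Fin b
  fresh z = cast (sym b≡a+p) (a ↑ʳ z)

  unembed : Fin b → Maybe (Fin a)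
  unembed y = [ just , (λ _ → nothing) ]′ (splitAt a (cast b≡a+p y))

  uncast : ∀ {y y′} → y′ ≡ cast b≡a+p y → cast (sym b≡a+p) y′ ≡ y
  uncast {y} e = trans (cong (cast (sym b≡a+p)) e) (cast-involutive (sym b≡a+p) b≡a+p y)

  embed-unembed : ∀ {x y} → unembed y ≡ just x → embed x ≡ y
  embed-unembed {y = y} h with splitAt a (cast b≡a+p y) in split
  ... | inj₁ _ with refl ← h = uncast (splitAt⁻¹-↑ˡ split)
  ... | inj₂ _ = contradiction h λ ()

  fresh-unembed : ∀ {y} → unembed y ≡ nothing → ∃[ z ] fresh z ≡ y
  fresh-unembed {y} h with splitAt a (cast b≡a+p y) in split
  ... | inj₂ z = z , uncast (splitAt⁻¹-↑ʳ split)

module Pullback {k} {u w e : Fin k → ℕ} (E : ∀ c → Extension (u c) (w c) (e c)) where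
  private
    module Column c = Extension (E c)

  lift : Row k u → Row k w
  lift f c = Column.embed c (f c)

  pullback : Interaction k w → Interaction k u
  pullback T c = Column.pull c (T c)

  Old : Interaction k w → Set
  Old T = ∀ c → All (Column.Embedded c) (T c)

  pullback-matches : ∀ {f T} → Matches (lift f) T → Matches f (pullback T)
  pullback-matches {T = T} h c = Column.pull-matchesAt c (T c) (h c)

  lift-matches : ∀ {f T} → Old T → Matches f (pullback T) → Matches (lift f) T
  lift-matches old h c = Column.embed-matchesAt c (old c) (h c)

  size-pullback : ∀ {T} → Old T → size (pullback T) ≡ size T
  size-pullback {T} old = size-cong (pullback T) T (λ c → Column.weight-pull c (old c))

  pullback-injective : ∀ {T₁ T₂} → Old T₁ → Old T₂ → pullback T₁ ≈I pullback T₂ → T₁ ≈I T₂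
  pullback-injective {T₁} {T₂} old₁ old₂ same c = begin
    T₁ c                                 ≡⟨ sym (Column.map-embed-pull c (old₁ c)) ⟩
    map (Column.embed c) (pullback T₁ c) ≡⟨ cong (map (Column.embed c)) (same c) ⟩
    map (Column.embed c) (pullback T₂ c) ≡⟨ Column.map-embed-pull c (old₂ c) ⟩
    T₂ c                                 ∎

-- Widening a single column

record ColumnExtension {k} (u w : Fin k → ℕ) (m : Fin k) (p : ℕ) : Set where
  field
    excess           : Fin k → ℕ
    column           : ∀ c → Extension (u c) (w c) (excess c)
    excess-at        : excess m ≡ p
    excess-elsewhere : ∀ {c} → c ≢ m → excess c ≡ 0

  module Column c = Extension (column c)

  fresh : Fin p → Fin (w m)
  fresh z = Column.fresh m (cast (sym excess-at) z)

  embedded-elsewhere : ∀ {c} → c ≢ m → ∀ y → Column.Embedded c y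
  embedded-elsewhere c≢m y with Column.embedded-or-fresh _ y
  ... | inj₁ embedded = embedded
  ... | inj₂ (z , _)  = contradiction (cast (excess-elsewhere c≢m) z) ¬Fin0

  embedded-or-fresh : ∀ y → Column.Embedded m y ⊎ ∃[ z ] fresh z ≡ y
  embedded-or-fresh y with Column.embedded-or-fresh m y
  ... | inj₁ embedded = inj₁ embedded
  ... | inj₂ (z , e)  =
    inj₂ (cast excess-at z , trans (cong (Column.fresh m) (cast-involutive (sym excess-at) excess-at z)) e)

removeColumn : ∀ {k} {u w : Fin (suc k) → ℕ} {m i p} → ColumnExtension u w m p →
               (i≢m : i ≢ m) → ColumnExtension (removeAt u i) (removeAt w i) (punchOut i≢m) p
removeColumn {i = i} X i≢m = record
  { excess           = excess ∘ punchIn i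
  ; column           = column ∘ punchIn i
  ; excess-at        = trans (cong excess (punchIn-punchOut i≢m)) excess-at
  ; excess-elsewhere = λ c≢m′ → excess-elsewhere λ e →
      c≢m′ (punchIn-injective i _ _ (trans e (sym (punchIn-punchOut i≢m))))
  }
  where open ColumnExtension X

single : ∀ {k} → Fin k → ℕ → Fin k → ℕ
single m p = updateAt (λ _ → 0) m (λ _ → p)

columnExtension : ∀ {k} {u w : Fin k → ℕ} {m p} →
                  (∀ c → w c ≡ u c + single m p c) → ColumnExtension u w m p
columnExtension {m = m} w≡u+single = record
  { excess           = single m _
  ; column           = λ c → castExtension (w≡u+single c)
  ; excess-at        = updateAt-updates m _
  ; excess-elsewhere = λ c≢m → updateAt-minimal _ m _ c≢m
  }

updateAt-+ : ∀ {k} (u : Fin k → ℕ) m p c → updateAt u m (_+ p) c ≡ u c + single m p c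
updateAt-+ u zero    p zero    = refl
updateAt-+ u zero    p (suc c) = sym (+-identityʳ (u (suc c)))
updateAt-+ u (suc m) p zero    = sym (+-identityʳ (u zero))
updateAt-+ u (suc m) p (suc c) = updateAt-+ (u ∘ suc) m p c

updateAt-+-swap : ∀ {k} (u : Fin k → ℕ) i j p q c →
                  updateAt (updateAt u i (_+ p)) j (_+ q) c ≡ updateAt u j (_+ q) c + single i p c
updateAt-+-swap u i j p q c = begin
  updateAt (updateAt u i (_+ p)) j (_+ q) c ≡⟨ updateAt-+ _ j q c ⟩
  updateAt u i (_+ p) c + single j q c      ≡⟨ cong (_+ single j q c) (updateAt-+ u i p c) ⟩
  u c + single i p c + single j q c         ≡⟨ xy∙z≈xz∙y (u c) _ _ ⟩
  u c + single j q c + single i p c         ≡⟨ cong (_+ single i p c) (sym (updateAt-+ u j q c)) ⟩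
  updateAt u j (_+ q) c + single i p c      ∎

blockIndex : ∀ N₁ p N₂ → Fin (N₁ + p * N₂) → Fin N₁ ⊎ (Fin p × Fin N₂)
blockIndex N₁ p N₂ = map₂ (remQuot N₂) ∘ splitAt N₁

blockIndex-surjective : ∀ {N₁ p N₂} → StrictlySurjective _≡_ (blockIndex N₁ p N₂)
blockIndex-surjective {N₁} {p} {N₂} (inj₁ r) =
  join N₁ (p * N₂) (inj₁ r) , cong (map₂ (remQuot N₂)) (splitAt-join N₁ (p * N₂) (inj₁ r))
blockIndex-surjective {N₁} {p} {N₂} (inj₂ (z , r)) =
  join N₁ (p * N₂) (inj₂ (combine z r)) ,
  trans (cong (map₂ (remQuot N₂)) (splitAt-join N₁ (p * N₂) (inj₂ (combine z r))))
        (cong inj₂ (remQuot-combine z r))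

module ExtendColumn {K} {u w : Fin (suc K) → ℕ} {m p} (X : ColumnExtension u w m p)
                    {t N₁ N₂} (A₁ : Array N₁ (suc K) u) (A₂ : Array N₂ K (removeAt u m))
                    (la₁ : IsLA t A₁) (la₂ : IsLA (pred t) A₂) where
  open ColumnExtension X
  open Pullback column
  module Rest = Pullback (column ∘ punchIn m)

  row : Fin N₁ ⊎ (Fin p × Fin N₂) → Row (suc K) w
  row (inj₁ r)       = lift (A₁ r)
  row (inj₂ (z , r)) = insert m (fresh z) (Rest.lift (A₂ r))

  punched : Interaction (suc K) w → Interaction K (removeAt w m)
  punched T c = T (punchIn m c)

  restrict : Interaction (suc K) w → Interaction K (removeAt u m)
  restrict T = Rest.pullback (punched T)

  old-punchIn : ∀ T → Rest.Old (punched T)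
  old-punchIn T c = universal (embedded-elsewhere (punchInᵢ≢i m c)) (T (punchIn m c))

  classify : ∀ T → Old T ⊎ ∃[ z ] T m ≡ just (fresh z)
  classify T = map₁ (λ old-at-m → insert {P = λ c → All (Column.Embedded c) (T c)} m old-at-m (old-punchIn T))
                    (classifyAt (T m))
    where
    classifyAt : ∀ my → All (Column.Embedded m) my ⊎ ∃[ z ] my ≡ just (fresh z)
    classifyAt nothing  = inj₁ nothing
    classifyAt (just y) = Sum.map just (λ (z , e) → z , cong just (sym e)) (embedded-or-fresh y)

  pullback-size : ∀ {T} → Old T → size T ≡ t → size (pullback T) ≡ t
  pullback-size old size≡t = trans (size-pullback old) size≡t

  restrict-size : ∀ {T z} → T m ≡ just (fresh z) → size T ≡ t → size (restrict T) ≡ pred t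
  restrict-size {T} T[m]≡z size≡t = begin
    size (restrict T)  ≡⟨ Rest.size-pullback (old-punchIn T) ⟩
    size (punched T)   ≡⟨ cong pred (sym (size-punchIn-just T m T[m]≡z)) ⟩
    pred (size T)      ≡⟨ cong pred size≡t ⟩
    pred t             ∎

  freshRow-matches : ∀ {T z r} → T m ≡ just (fresh z) →
                     Matches (A₂ r) (restrict T) → Matches (row (inj₂ (z , r))) T
  freshRow-matches {T} T[m]≡z h =
    matches-insert (λ _ e → just-injective (trans (sym T[m]≡z) e)) (Rest.lift-matches (old-punchIn T) h)

  freshRow-matches⁻ : ∀ {T z r} → Matches (row (inj₂ (z , r))) T → Matches (A₂ r) (restrict T)
  freshRow-matches⁻ h = Rest.pullback-matches (insert-matches-punchIn h)

  oldRow : ∀ {T} → Old T → size T ≡ t → ∃[ r ] Matches (row (inj₁ r)) T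
  oldRow {T} old size≡t =
    let (r , h) = isLA⇒covering la₁ (pullback T) (pullback-size old size≡t) in r , lift-matches old h

  freshRow : ∀ {T z} → T m ≡ just (fresh z) → size T ≡ t → ∃[ r ] Matches (row (inj₂ (z , r))) T
  freshRow {T} T[m]≡z size≡t =
    let (r , h) = isLA⇒covering la₂ (restrict T) (restrict-size {T} T[m]≡z size≡t)
    in r , freshRow-matches T[m]≡z h

  covering : Covering t row
  covering T size≡t with classify T
  ... | inj₁ old          = let (r , h) = oldRow old size≡t in inj₁ r , h
  ... | inj₂ (z , T[m]≡z) = let (r , h) = freshRow T[m]≡z size≡t in inj₂ (z , r) , h

  old-fresh-apart : ∀ {T₁ T₂ z} → Old T₁ → size T₁ ≡ t → T₂ m ≡ just (fresh z) →
                    ¬ (∀ i → Matches (row i) T₁ → Matches (row i) T₂)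
  old-fresh-apart old size≡t T₂[m]≡z H =
    let (r , h) = oldRow old size≡t in Column.embed≢fresh m (A₁ r m) _ (H (inj₁ r) h m _ T₂[m]≡z)

  old-separated : ∀ {T₁ T₂} → Old T₁ → Old T₂ → size T₁ ≡ t → size T₂ ≡ t →
                  SameRows row T₁ T₂ → T₁ ≈I T₂
  old-separated old₁ old₂ s₁ s₂ same =
    pullback-injective old₁ old₂
      (isLA⇒separating la₁ _ _ (pullback-size old₁ s₁) (pullback-size old₂ s₂) λ r →
        (pullback-matches ∘ proj₁ (same (inj₁ r)) ∘ lift-matches old₁) ,
        (pullback-matches ∘ proj₂ (same (inj₁ r)) ∘ lift-matches old₂))

  fresh-separated : ∀ {T₁ T₂ z₁ z₂} → T₁ m ≡ just (fresh z₁) → T₂ m ≡ just (fresh z₂) →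
                    size T₁ ≡ t → size T₂ ≡ t → SameRows row T₁ T₂ → T₁ ≈I T₂
  fresh-separated {T₁} {T₂} {z₁} {z₂} T₁[m]≡z₁ T₂[m]≡z₂ s₁ s₂ same =
    insert {P = λ c → T₁ c ≡ T₂ c} m same-at
      (Rest.pullback-injective {punched T₁} {punched T₂} (old-punchIn T₁) (old-punchIn T₂) same-restrict)
    where
    fresh-z₁≡z₂ : fresh z₁ ≡ fresh z₂
    fresh-z₁≡z₂ = let (r , h) = freshRow {T₁} T₁[m]≡z₁ s₁ in
      insert-matchesAt (proj₁ (same (inj₂ (z₁ , r))) h) _ T₂[m]≡z₂

    same-at : T₁ m ≡ T₂ m
    same-at = trans T₁[m]≡z₁ (trans (cong just fresh-z₁≡z₂) (sym T₂[m]≡z₂))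

    T₂[m]≡z₁ : T₂ m ≡ just (fresh z₁)
    T₂[m]≡z₁ = trans (sym same-at) T₁[m]≡z₁

    same-restrict : restrict T₁ ≈I restrict T₂
    same-restrict =
      isLA⇒separating la₂ _ _ (restrict-size {T₁} T₁[m]≡z₁ s₁) (restrict-size {T₂} T₂[m]≡z₁ s₂) λ r →
        (freshRow-matches⁻ ∘ proj₁ (same (inj₂ (z₁ , r))) ∘ freshRow-matches T₁[m]≡z₁) ,
        (freshRow-matches⁻ ∘ proj₂ (same (inj₂ (z₁ , r))) ∘ freshRow-matches T₂[m]≡z₁)

  separating : Separating t row
  separating T₁ T₂ s₁ s₂ same with classify T₁ | classify T₂
  ... | inj₁ old₁     | inj₁ old₂     = old-separated old₁ old₂ s₁ s₂ same
  ... | inj₁ old₁     | inj₂ (_ , e₂) = ⊥-elim (old-fresh-apart old₁ s₁ e₂ (proj₁ ∘ same))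
  ... | inj₂ (_ , e₁) | inj₁ old₂     = ⊥-elim (old-fresh-apart old₂ s₂ e₁ (proj₂ ∘ same))
  ... | inj₂ (_ , e₁) | inj₂ (_ , e₂) = fresh-separated e₁ e₂ s₁ s₂ same

  extended : LAExists t (N₁ + p * N₂) (suc K) w
  extended = row ∘ blockIndex N₁ p N₂ ,
             isLA (covering-∘ blockIndex-surjective covering)
                  (separating-∘ blockIndex-surjective separating)

extendColumn : ∀ {K} {u w : Fin (suc K) → ℕ} {m p t N₁ N₂} → ColumnExtension u w m p →
               LAExists t N₁ (suc K) u → LAExists (pred t) N₂ K (removeAt u m) →
               LAExists t (N₁ + p * N₂) (suc K) w
extendColumn X (A₁ , la₁) (A₂ , la₂) = ExtendColumn.extended X A₁ A₂ la₁ la₂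

extendColumn′ : ∀ {K} {u w : Fin (suc K) → ℕ} {m p N₁ N₂} t → ColumnExtension u w m p →
                LAExists t N₁ (suc K) u → (∀ s → suc s ≡ t → LAExists s N₂ K (removeAt u m)) →
                LAExists t (N₁ + p * N₂) (suc K) w
extendColumn′ {p = p} {N₂ = N₂} zero X 𝒜₁ _ = LAExists₀-extend 𝒜₁ Column.embed (p * N₂)
  where open ColumnExtension X
extendColumn′ (suc s) X 𝒜₁ 𝒜₂ = extendColumn X 𝒜₁ (𝒜₂ s refl)

rowCount : ∀ N₁ N₂ N₃ N₄ p q →
           N₁ + q * N₃ + p * (N₂ + q * N₄) ≡ N₁ + p * N₂ + q * N₃ + p * q * N₄
rowCount = solve-∀

mainTheorem20 : (n t : ℕ) → 1 ≤ t → t < suc (suc n) →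
    (v : Fin (suc (suc n)) → ℕ) → (∀ c → 1 ≤ v c) →
    (i j : Fin (suc (suc n))) → (i<j : i Data.Fin.< j) →
    (p q N₁ N₂ N₃ N₄ : ℕ) →
    LAExists t N₁ (suc (suc n)) v →
    LAExists (Data.Nat.pred t) N₂ (suc n) (removeAt v i) →
    LAExists (Data.Nat.pred t) N₃ (suc n) (removeAt v j) →
    (∀ s → s + 2 ≡ t → LAExists s N₄ n (remove2 v i j i<j)) →
    LAExists t (N₁ + p * N₂ + q * N₃ + p * q * N₄) (suc (suc n))
      (updateAt (updateAt v i (λ x → x + p)) j (λ x → x + q))
mainTheorem20 n zero () _ v _ i j i<j p q N₁ N₂ N₃ N₄ 𝒜₁ 𝒜₂ 𝒜₃ 𝒜₄
mainTheorem20 n (suc t) _ _ v _ i j i<j p q N₁ N₂ N₃ N₄ 𝒜₁ 𝒜₂ 𝒜₃ 𝒜₄ =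
  subst (λ N → LAExists (suc t) N (suc (suc n)) w) (rowCount N₁ N₂ N₃ N₄ p q)
    (extendColumn widen-i 𝒜₁₃ 𝒜₂₄)
  where
  w : Fin (suc (suc n)) → ℕ
  w = updateAt (updateAt v i (_+ p)) j (_+ q)

  widen-j : ColumnExtension v (updateAt v j (_+ q)) j q
  widen-j = columnExtension (updateAt-+ v j q)

  widen-i : ColumnExtension (updateAt v j (_+ q)) w i p
  widen-i = columnExtension (updateAt-+-swap v i j p q)

  𝒜₁₃ : LAExists (suc t) (N₁ + q * N₃) (suc (suc n)) (updateAt v j (_+ q))
  𝒜₁₃ = extendColumn widen-j 𝒜₁ 𝒜₃

  𝒜₂₄ : LAExists t (N₂ + q * N₄) (suc n) (removeAt (updateAt v j (_+ q)) i)
  𝒜₂₄ = extendColumn′ t (removeColumn widen-j (<⇒≢ i<j)) 𝒜₂ λ s suc-s≡t →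
    𝒜₄ s (trans (+-comm s 2) (cong suc suc-s≡t))
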